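{- For $1\le j\le L$ let $\mathcal{K}_j\subseteq\mathbb{Z}^+$ be finite and let $h_j(u)=\sum_{r\in\mathcal{K}_j\cup\{0\}}c_{j,r}u^r\in\mathbb{F}_q[t][u]$ be supported on $\mathcal{K}_j$; let $\mathcal{K}=\mathcal{K}_1\cup\dots\cup\mathcal{K}_L$. Suppose the $\mathcal{K}^*$-portion of $(h_j)_{j=1}^L$ is linearly independent, and let $\beta_1,\dots,\beta_L\in\mathbb{K}_\infty$. Then there exist an $L\times L$ matrix $\mathcal{T}$ with entries in $\mathbb{F}_q[t]$ and polynomials $g_1,\dots,g_L\in\mathbb{F}_q[t][u]$ such that: (1) each $g_j$ is supported on a subset of $\mathcal{K}$ (i.e. every $u^r$ with $r\ge1$ occurring in $g_j$ with nonzero coefficient has $r\in\mathcal{K}$); (2) $\mathcal{T}\,(h_1(u),\dots,h_L(u))^T=(g_1(u),\dots,g_L(u))^T$; (3) there exist $T_1,\dots,T_L\in\mathcal{K}^*$ such that $[g_i]_{T_j}=0$ whenever $i\ne j$; (4) there exist $\gamma_1,\dots,\gamma_L\in\mathbb{K}_\infty$ with $\beta_1h_1(u)+\dots+\beta_Lh_L(u)=\gamma_1g_1(u)+\dots+\gamma_Lg_L(u)$.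
   Context: $\mathbb{F}_q$ is the finite field with $q$ elements, $p$ its characteristic; $\mathbb{K}=\mathbb{F}_q(t)$, $\mathbb{K}_\infty=\mathbb{F}_q((1/t))$. $[f]_i$ denotes the coefficient of $u^i$ in $f$. For $j,r\in\mathbb{Z}^+$, $j\preceq_p r$ means $p\nmid\binom rj$. $\mathcal{S}(\mathcal{K})=\{j\in\mathbb{Z}^+: j\preceq_p r\text{ for some }r\in\mathcal{K}\}$, $\mathcal{K}^*=\{k\in\mathcal{K}: p\nmid k\text{ and }p^vk\notin\mathcal{S}(\mathcal{K})\ \forall v\in\mathbb{Z}^+\}$. A polynomial is supported on $\mathcal{K}$ if it equals $\sum_{r\in\mathcal{K}\cup\{0\}}\alpha_ru^r$ with $\alpha_r\ne0$ for $r\in\mathcal{K}$. The $\mathcal{K}^*$-portion of $h_j$ is $h_j^*(u)=\sum_{r\in\mathcal{K}_j\cap\mathcal{K}^*}c_{j,r}u^r$; the $\mathcal{K}^*$-portion of $(h_j)_{j=1}^L$ is linearly independent if $h_1^*,\dots,h_L^*$ are linearly independent over $\mathbb{K}$. -}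

module Defs where

open import Level using (0ℓ)
open import Algebra.Bundles using (CommutativeRing)
open import Data.Nat as ℕ using (ℕ; zero; suc; _≤_; _^_)
open import Data.Nat.Divisibility using (_∣_)
open import Data.Nat.Primality using (Prime)
open import Data.Nat.Combinatorics using (_C_)
open import Data.Integer as ℤ using (ℤ; _>_)
open import Data.Fin using (Fin; zero; suc)
open import Data.List using (List; []; _∷_; concat; tabulate)
open import Data.List.Membership.Propositional using (_∈_; _∉_)
open import Data.List.Membership.DecPropositional ℕ._≟_ using (_∈?_)
open import Data.List.Relation.Unary.All using (All)
open import Data.Product using (Σ; ∃; _×_)
open import Relation.Nullary using (¬_; yes; no)
open import Relation.Binary.PropositionalEquality using (_≡_)

_⪯[_]_ : ℕ → ℕ → ℕ → Set
j ⪯[ p ] r = ¬ (p ∣ (r C j))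

-- A finite subset of ℤ⁺ is represented by a list of naturals, all ≥ 1.
PosSet : List ℕ → Set
PosSet K = All (1 ≤_) K

S : ℕ → List ℕ → ℕ → Set
S p K j = (1 ≤ j) × Σ ℕ (λ r → (r ∈ K) × (j ⪯[ p ] r))

KStar : ℕ → List ℕ → ℕ → Set
KStar p K k = (k ∈ K) × ¬ (p ∣ k) × ((v : ℕ) → 1 ≤ v → ¬ S p K (p ^ v ℕ.* k))

module Over (F : CommutativeRing 0ℓ 0ℓ) where
  open CommutativeRing F using (_≈_; _+_; _*_; 0#; 1#) renaming (Carrier to A)

  IsField : Set
  IsField = ¬ (1# ≈ 0#) × ((x : A) → ¬ (x ≈ 0#) → Σ A (λ y → x * y ≈ 1#))

  HasCard : ℕ → Set
  HasCard q = Σ (Fin q → A) (λ e →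
                ((x : A) → Σ (Fin q) (λ i → e i ≈ x)) ×
                ((i j : Fin q) → e i ≈ e j → i ≡ j))

  natF : ℕ → A
  natF zero    = 0#
  natF (suc n) = 1# + natF n

  HasChar : ℕ → Set
  HasChar p = Prime p × (natF p ≈ 0#)

  -- F[t]: coefficient lists (index i = coefficient of t^i)
  PolyT : Set
  PolyT = List A

  coeffT : PolyT → ℕ → A
  coeffT []       _       = 0#
  coeffT (c ∷ cs) zero    = c
  coeffT (c ∷ cs) (suc i) = coeffT cs i

  _≈T_ : PolyT → PolyT → Set
  a ≈T b = (i : ℕ) → coeffT a i ≈ coeffT b i

  IsZeroT : PolyT → Set
  IsZeroT a = a ≈T []

  _+T_ : PolyT → PolyT → PolyT
  []       +T b        = b
  (x ∷ a)  +T []       = x ∷ a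
  (x ∷ a)  +T (y ∷ b)  = (x + y) ∷ (a +T b)

  scaleT : A → PolyT → PolyT
  scaleT x []       = []
  scaleT x (y ∷ b)  = (x * y) ∷ scaleT x b

  _*T_ : PolyT → PolyT → PolyT
  []      *T b = []
  (x ∷ a) *T b = scaleT x b +T (0# ∷ (a *T b))

  sumT : ∀ {n} → (Fin n → PolyT) → PolyT
  sumT {zero}  f = []
  sumT {suc n} f = f zero +T sumT (λ i → f (suc i))

  sumA : ∀ {n} → (Fin n → A) → A
  sumA {zero}  f = 0#
  sumA {suc n} f = f zero + sumA (λ i → f (suc i))

  -- F[t][u]: lists of elements of F[t] (index r = coefficient of u^r)
  PolyTU : Set
  PolyTU = List PolyT

  coeffU : PolyTU → ℕ → PolyT
  coeffU []       _       = []
  coeffU (c ∷ cs) zero    = c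
  coeffU (c ∷ cs) (suc r) = coeffU cs r

  SupportedOn : List ℕ → PolyTU → Set
  SupportedOn K f = (r : ℕ) → 1 ≤ r →
    ((r ∈ K → ¬ IsZeroT (coeffU f r)) × (r ∉ K → IsZeroT (coeffU f r)))

  SupportedInSubsetOf : List ℕ → PolyTU → Set
  SupportedInSubsetOf K f = (r : ℕ) → 1 ≤ r → ¬ IsZeroT (coeffU f r) → r ∈ K

  -- K*-portion: [h_j^*]_r = c_{j,r} if r ∈ K_j ∩ K*, and 0 otherwise.
  -- (The K* condition is imposed where the portion is used, see below.)
  starCoeffOnKj : List ℕ → PolyTU → ℕ → PolyT
  starCoeffOnKj Kj h r with r ∈? Kj
  ... | yes _ = coeffU h r
  ... | no  _ = []

  -- The K*-portion of (h_j)_{j=1}^L (h_j supported on K_j) is linearly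
  -- independent: Σ_j c_j h_j^* = 0 (all u-coefficients vanish; those with
  -- r ∉ K* vanish by definition of h_j^*) forces all c_j = 0.
  -- Coefficients c_j range over F[t]; by clearing denominators this is
  -- linear independence over K = F(t).
  KStarPortionLinIndep : ∀ {L} → ℕ → (Fin L → List ℕ) → (Fin L → PolyTU) → Set
  KStarPortionLinIndep {L} p Ks h =
    (c : Fin L → PolyT) →
    ((r : ℕ) → KStar p (concat (tabulate Ks)) r →
       IsZeroT (sumT (λ j → c j *T starCoeffOnKj (Ks j) (h j) r))) →
    (j : Fin L) → IsZeroT (c j)

  -- K_∞ = F((1/t)): a n = coefficient of t^n, zero for n large
  record Laurent : Set where
    field
      coeffL : ℤ → A
      bound  : Σ ℤ (λ N → (n : ℤ) → n > N → coeffL n ≈ 0#)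
  open Laurent public

  -- coefficient of t^n in γ · a (γ ∈ K_∞, a ∈ F[t]) : Σ_i γ_{n-i} a_i
  mulLT : (ℤ → A) → PolyT → ℤ → A
  mulLT γ []       n = 0#
  mulLT γ (x ∷ xs) n = γ n * x + mulLT γ xs (n ℤ.- ℤ.+ 1)

  -- coefficient of u^r t^n in Σ_j γ_j f_j  (γ_j ∈ K_∞, f_j ∈ F[t][u])
  linCombCoeff : ∀ {L} → (Fin L → Laurent) → (Fin L → PolyTU) → ℕ → ℤ → A
  linCombCoeff γ f r n = sumA (λ j → mulLT (coeffL (γ j)) (coeffU (f j) r) n)

KUnion : ∀ {L} → (Fin L → List ℕ) → List ℕ
KUnion Ks = concat (tabulate Ks)

-- Fraction-free Gaussian elimination over 𝔽_q[t].  Keep a triple (𝒯, g, γ) with g = 𝒯h,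
-- Σ βⱼhⱼ = Σ γⱼgⱼ and the K*-portions of g₁, …, g_L linearly independent, starting from
-- (1, h, β).  For each row M, independence yields r ∈ K* with [g_M]_r ≠ 0, and the row operations
-- gᵢ ← [g_M]_r gᵢ − [gᵢ]_r g_M (i ≠ M) clear column r off row M; columns cleared before stay
-- cleared because both rows involved vanish there.  A row operation with nonzero leading factor is
-- invertible over 𝔽_q(t), so independence is preserved, and Σ γⱼgⱼ is kept fixed by dividing γᵢ by
-- [g_M]_r, which is possible because a Laurent series in 1/t can be divided by any nonzero polynomial.

module Submission where

open import Defs
open import Level using (0ℓ)
open import Algebra.Bundles using (CommutativeRing; CommutativeMonoid; Semiring)
open import Data.Nat using (ℕ)
open import Data.Integer using (ℤ)
open import Data.Fin using (Fin)
open import Data.List using (List; allFin)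
open import Data.List.Membership.Propositional using (_∈_)
open import Data.List.Membership.Propositional.Properties using (∈-allFin; ∈-concat⁺)
open import Data.List.Relation.Unary.Any.Properties using (tabulate⁺)
open import Data.List.Relation.Unary.Unique.Propositional.Properties using (allFin⁺)
open import Data.Nat.Base using (nonTrivial⇒n>1)
open import Data.Nat.Primality using (prime⇒nonTrivial)
open import Data.Product using (Σ; _×_; _,_)
open import Relation.Nullary using (¬_)
open import Relation.Binary.Definitions using (Decidable)
open import Relation.Binary.PropositionalEquality using (_≡_)

module FiniteSums {a ℓ} (M : CommutativeMonoid a ℓ) where

  open import Data.Nat using (zero; suc)
  open import Data.Fin using (zero; suc; punchIn; punchOut)
  open import Data.Fin.Properties using (punchInᵢ≢i; punchIn-punchOut; punchIn-injective)
  open import Data.Vec.Functional using (Vector; removeAt)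
  open import Relation.Nullary using (contradiction)
  open import Relation.Binary.PropositionalEquality as ≡ using (_≢_)

  open CommutativeMonoid M
    renaming (Carrier to A; _∙_ to _+_; ε to 0#; ∙-cong to +-cong; ∙-congˡ to +-congˡ; ∙-congʳ to +-congʳ;
              assoc to +-assoc; identityʳ to +-identityʳ)
  open import Algebra.Properties.CommutativeMonoid.Sum M public using (sum)
  open import Algebra.Properties.CommutativeMonoid.Sum M using (sum-remove; sum-cong-≋; sum-replicate-zero)
  open import Relation.Binary.Reasoning.Setoid setoid

  sum-single : ∀ {n} {f : Vector A n} i → (∀ k → k ≢ i → f k ≈ 0#) → sum f ≈ f i
  sum-single {suc n} {f} i f≈0 = begin
    sum f                     ≈⟨ sum-remove f ⟩
    f i + sum (removeAt f i)  ≈⟨ +-congˡ (trans (sum-cong-≋ λ k → f≈0 (punchIn i k) (punchInᵢ≢i i k))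
                                                (sum-replicate-zero n)) ⟩
    f i + 0#                  ≈⟨ +-identityʳ (f i) ⟩
    f i                       ∎

  sum-cong-except₂ : ∀ {n} {f g : Vector A n} i j → i ≢ j → (∀ k → k ≢ i → k ≢ j → f k ≈ g k) →
                     f i + f j ≈ g i + g j → sum f ≈ sum g
  sum-cong-except₂ {suc zero}    zero zero i≢j _ _ = contradiction ≡.refl i≢j
  sum-cong-except₂ {suc (suc n)} {f} {g} i j i≢j f≈g fi+fj≈gi+gj = begin
    sum f                      ≈⟨ split f ⟩
    f i + (f j + sum (rest f)) ≈⟨ +-assoc (f i) (f j) _ ⟨
    (f i + f j) + sum (rest f) ≈⟨ +-cong fi+fj≈gi+gj (sum-cong-≋ λ k → f≈g _ (punchInᵢ≢i i _) (rest≢j k)) ⟩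
    (g i + g j) + sum (rest g) ≈⟨ +-assoc (g i) (g j) _ ⟩
    g i + (g j + sum (rest g)) ≈⟨ split g ⟨
    sum g                      ∎
    where
    j′ = punchOut i≢j
    rest : Vector A (suc (suc n)) → Vector A n
    rest t = removeAt (removeAt t i) j′
    split : ∀ t → sum t ≈ t i + (t j + sum (rest t))
    split t = trans (sum-remove t) (+-congˡ (trans (sum-remove (removeAt t i))
                (+-congʳ (reflexive (≡.cong t (punchIn-punchOut i≢j))))))
    rest≢j : ∀ k → punchIn i (punchIn j′ k) ≢ j
    rest≢j k eq = punchInᵢ≢i j′ k (punchIn-injective i _ _ (≡.trans eq (≡.sym (punchIn-punchOut i≢j))))

module SemiringSums {a ℓ} (R : Semiring a ℓ) where

  open import Data.Vec.Functional using (Vector)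

  open Semiring R renaming (Carrier to A)
  open import Algebra.Properties.Semiring.Sum R using (sum; sum-cong-≋; ∑-distrib-+; *-distribˡ-sum)
  open import Relation.Binary.Reasoning.Setoid setoid

  sum-*-+-* : ∀ {n} x y (u v w : Vector A n) →
              sum (λ k → (x * u k + y * v k) * w k) ≈ x * sum (λ k → u k * w k) + y * sum (λ k → v k * w k)
  sum-*-+-* x y u v w = begin
    sum (λ k → (x * u k + y * v k) * w k)
      ≈⟨ sum-cong-≋ (λ k → trans (distribʳ (w k) _ _) (+-cong (*-assoc x (u k) (w k)) (*-assoc y (v k) (w k)))) ⟩
    sum (λ k → x * (u k * w k) + y * (v k * w k))
      ≈⟨ ∑-distrib-+ (λ k → x * (u k * w k)) (λ k → y * (v k * w k)) ⟩
    sum (λ k → x * (u k * w k)) + sum (λ k → y * (v k * w k))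
      ≈⟨ +-cong (*-distribˡ-sum x (λ k → u k * w k)) (*-distribˡ-sum y (λ k → v k * w k)) ⟨
    x * sum (λ k → u k * w k) + y * sum (λ k → v k * w k)
      ∎

module IndexArithmetic where

  open import Data.Nat as ℕ using (suc)
  import Data.Nat.Properties as ℕ
  open import Data.Integer using (+_; -[1+_]; _+_; _-_; -_; _<_; _≤_; ∣_∣; +<+; +≤+; -≤+)
  open import Data.Integer using () renaming (suc to sucℤ)
  open import Data.Integer.Properties
  open import Data.Integer.Tactic.RingSolver using (solve-∀)
  open import Relation.Binary.PropositionalEquality using (_≡_; subst; subst₂)

  [n-1]-k≡n-[1+k] : ∀ n k → (n - + 1) - + k ≡ n - + suc k
  [n-1]-k≡n-[1+k] n k = lemma n (+ k)
    where lemma : ∀ n k → (n - + 1) - k ≡ n - (+ 1 + k)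
          lemma = solve-∀

  [n-d]+d≡n : ∀ n d → (n - + d) + + d ≡ n
  [n-d]+d≡n n d = lemma n (+ d)
    where lemma : ∀ n d → (n - d) + d ≡ n
          lemma = solve-∀

  n-d<n-k : ∀ {k d} n → k ℕ.< d → n - + d < n - + k
  n-d<n-k n k<d = +-monoʳ-< n (neg-mono-< (+<+ k<d))

  m<[m+d]-k : ∀ {k d} m → k ℕ.< d → m < (m + + d) - + k
  m<[m+d]-k {k} {d} m k<d = subst (_< (m + + d) - + k) (lemma m (+ d)) (n-d<n-k (m + + d) k<d)
    where lemma : ∀ m d → (m + d) - d ≡ m
          lemma = solve-∀

  N+[1+l]<n⇒N<n : ∀ N l {n} → N + + suc l < n → N < n
  N+[1+l]<n⇒N<n N l = ≤-<-trans (i≤i+j N (+ suc l))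

  N+[1+l]<n⇒N+l<n-1 : ∀ N l {n} → N + + suc l < n → N + + l < n - + 1
  N+[1+l]<n⇒N+l<n-1 N l {n} lt = subst (_< n - + 1) (lemma N (+ l)) (+-monoˡ-< (- + 1) lt)
    where lemma : ∀ N l → (N + (+ 1 + l)) - + 1 ≡ N + l
          lemma = solve-∀

  i≤+∣i∣ : ∀ i → i ≤ + ∣ i ∣
  i≤+∣i∣ (+ n)    = ≤-refl
  i≤+∣i∣ -[1+ n ] = -≤+

  j<i+[1+∣j-i∣] : ∀ i j → j < i + + suc ∣ j - i ∣
  j<i+[1+∣j-i∣] i j = begin-strict
    j                   ≡⟨ lemma i j ⟨
    i + (j - i)         ≤⟨ +-monoʳ-≤ i (i≤+∣i∣ (j - i)) ⟩
    i + + ∣ j - i ∣     <⟨ +-monoʳ-< i (+<+ (ℕ.n<1+n _)) ⟩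
    i + + suc ∣ j - i ∣ ∎
    where open ≤-Reasoning
          lemma : ∀ i j → i + (j - i) ≡ j
          lemma = solve-∀

  N<m+f⇒N<m+[f+e] : ∀ {N} m f e → N < m + + f → N < m + + (f ℕ.+ e)
  N<m+f⇒N<m+[f+e] m f e lt = <-≤-trans lt (+-monoʳ-≤ m (+≤+ (ℕ.m≤m+n f e)))

  N<m+[1+f]⇒N<[m+d]-k+f : ∀ {N k d} m f → k ℕ.< d → N < m + + suc f → N < ((m + + d) - + k) + + f
  N<m+[1+f]⇒N<[m+d]-k+f {N} {k} {d} m f k<d lt = begin-strict
    N                        <⟨ lt ⟩
    m + + suc f              ≡⟨ lemma m (+ f) ⟩
    sucℤ m + + f             ≤⟨ +-monoˡ-≤ (+ f) (i<j⇒suc[i]≤j (m<[m+d]-k m k<d)) ⟩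
    ((m + + d) - + k) + + f  ∎
    where open ≤-Reasoning
          lemma : ∀ m f → m + (+ 1 + f) ≡ (+ 1 + m) + f
          lemma = solve-∀

  N-d<n-d⇒N<n : ∀ {N n} d → N - + d < n - + d → N < n
  N-d<n-d⇒N<n {N} {n} d lt = subst₂ _<_ ([n-d]+d≡n N d) ([n-d]+d≡n n d) (+-monoˡ-< (+ d) lt)

module StarIndices where

  open import Data.Nat as ℕ using (ℕ; zero; suc; _≤_; _<_; _^_; _*_; _+_; z≤n; s≤s; _≤?_; _<?_)
  open import Data.Nat.Properties
  open import Data.Nat.Divisibility using (_∣_; _∣?_; _∣0)
  open import Data.Nat.Combinatorics using (_C_; k>n⇒nCk≡0)
  open import Data.List.Extrema ≤-totalOrder using (max; xs≤max)
  import Data.List.Relation.Unary.All as All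
  open import Data.List.Relation.Unary.Any using (any?)
  open import Data.List.Membership.Propositional using (find; lose)
  open import Data.List.Membership.DecPropositional _≟_ using (_∈?_)
  open import Data.Product using (_,_; proj₁; proj₂)
  open import Relation.Nullary using (Dec; yes; no; ¬?; contradiction)
  open import Relation.Nullary.Decidable using (_×-dec_; _→-dec_; map′)
  open import Relation.Binary.PropositionalEquality using (refl; subst; sym; cong)

  n<m^n : ∀ {m} → 1 < m → ∀ n → n < m ^ n
  n<m^n 1<m zero    = s≤s z≤n
  n<m^n {m} 1<m (suc n) = begin-strict
    suc n          ≤⟨ n<m^n 1<m n ⟩
    m ^ n          <⟨ m<m+n (m ^ n) (<-≤-trans (s≤s z≤n) (n<m^n 1<m n)) ⟩
    m ^ n + m ^ n  ≡⟨ cong (m ^ n +_) (sym (+-identityʳ (m ^ n))) ⟩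
    2 * m ^ n      ≤⟨ *-monoˡ-≤ (m ^ n) 1<m ⟩
    m ^ suc n      ∎
    where open ≤-Reasoning

  KStar⇒positive : ∀ {p K r} → KStar p K r → 1 ≤ r
  KStar⇒positive {r = zero}  (_ , p∤0 , _) = contradiction (_ ∣0) p∤0
  KStar⇒positive {r = suc r} _             = s≤s z≤n

  module _ {p : ℕ} (1<p : 1 < p) where

    S⇒≤max : ∀ {K j} → S p K j → j ≤ max 0 K
    S⇒≤max {K} {j} (_ , r , r∈K , j⪯r) with j ≤? r
    ... | yes j≤r = ≤-trans j≤r (All.lookup (xs≤max 0 K) r∈K)
    ... | no  j≰r = contradiction (subst (p ∣_) (sym (k>n⇒nCk≡0 (≰⇒> j≰r))) (p ∣0)) j⪯r

    S? : ∀ K j → Dec (S p K j)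
    S? K j = (1 ≤? j) ×-dec map′ find (λ (r , r∈K , j⪯r) → lose r∈K j⪯r)
                                     (any? (λ r → ¬? (p ∣? (r C j))) K)

    KStar? : ∀ K k → Dec (KStar p K k)
    KStar? K k with k ∈? K | p ∣? k
    ... | no  k∉K | _      = no λ k* → k∉K (proj₁ k*)
    ... | yes _   | yes p∣k = no λ k* → proj₁ (proj₂ k*) p∣k
    ... | yes k∈K | no  p∤k = map′ (λ bounded → k∈K , p∤k , unbounded (λ {v} → bounded {v}))
                                   (λ k* {v} _ → proj₂ (proj₂ k*) v)
                                   (allUpTo? (λ v → 1 ≤? v →-dec ¬? (S? K (p ^ v * k))) (max 0 K))
      where
      -- Every element of S(K) is at most max K, whereas pᵛk > v ≥ max K once v ≥ max K.
      unbounded : (∀ {v} → v < max 0 K → 1 ≤ v → ¬ S p K (p ^ v * k)) → ∀ v → 1 ≤ v → ¬ S p K (p ^ v * k)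
      unbounded bounded v 1≤v S[pᵛk] with v <? max 0 K
      ... | yes v<max = bounded v<max 1≤v S[pᵛk]
      ... | no  v≮max = <⇒≱ (<-≤-trans (n<m^n 1<p v) (m≤m*n (p ^ v) k))
                              (≤-trans (S⇒≤max S[pᵛk]) (≮⇒≥ v≮max))
        where instance _ = ℕ.≢-nonZero (λ { refl → p∤k (p ∣0) })

module Polynomials (R : CommutativeRing 0ℓ 0ℓ) where

  open import Data.Nat using (zero; suc)
  open import Data.List using ([]; _∷_; _++_)
  open import Data.Product using (_,_; proj₁; proj₂)
  open import Data.Sum as Sum using (_⊎_; inj₁; inj₂; [_,_]′)
  open import Relation.Nullary using (Dec; yes; no; contradiction)
  open import Relation.Binary.Bundles using (Setoid)
  open import Relation.Binary.Definitions using (Decidable)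
  import Relation.Binary.PropositionalEquality as ≡
  import Algebra.Consequences.Setoid as Consequences

  open CommutativeRing R renaming (Carrier to A) hiding (zero)
  open Over R
  open import Algebra.Properties.Ring ring using (-1*x≈-x)

  -- Coefficientwise equality, wrapped in a record so that both polynomials can be inferred.
  infix 4 _≋_
  record _≋_ (a b : PolyT) : Set where
    constructor coeffwise
    field coeff-≈ : a ≈T b
  open _≋_ public

  ≋-refl : ∀ {a} → a ≋ a
  ≋-refl = coeffwise λ _ → refl

  ≋-sym : ∀ {a b} → a ≋ b → b ≋ a
  ≋-sym (coeffwise e) = coeffwise λ i → sym (e i)

  ≋-trans : ∀ {a b c} → a ≋ b → b ≋ c → a ≋ c
  ≋-trans (coeffwise e) (coeffwise e′) = coeffwise λ i → trans (e i) (e′ i)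

  ∷-cong : ∀ {x y a b} → x ≈ y → a ≋ b → (x ∷ a) ≋ (y ∷ b)
  ∷-cong x≈y (coeffwise e) = coeffwise λ { zero → x≈y ; (suc i) → e i }

  ∷-injective : ∀ {x y a b} → (x ∷ a) ≋ (y ∷ b) → x ≈ y × a ≋ b
  ∷-injective (coeffwise e) = e zero , coeffwise λ i → e (suc i)

  ≋-reflexive : ∀ {a b} → a ≡ b → a ≋ b
  ≋-reflexive ≡.refl = ≋-refl

  ≋-setoid : Setoid 0ℓ 0ℓ
  ≋-setoid = record { Carrier = PolyT ; _≈_ = _≋_
                    ; isEquivalence = record { refl = ≋-refl ; sym = ≋-sym ; trans = ≋-trans } }

  ≋[]-∷ : ∀ {x a} → x ≈ 0# → a ≋ [] → (x ∷ a) ≋ []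
  ≋[]-∷ x≈0 (coeffwise e) = coeffwise λ { zero → x≈0 ; (suc i) → e i }

  ∷-≋[] : ∀ {x a} → (x ∷ a) ≋ [] → x ≈ 0# × a ≋ []
  ∷-≋[] (coeffwise e) = e zero , coeffwise λ i → e (suc i)

  -T_ : PolyT → PolyT
  -T a = scaleT (- 1#) a

  oneT : PolyT
  oneT = 1# ∷ []

  coeff-+T : ∀ a b i → coeffT (a +T b) i ≈ coeffT a i + coeffT b i
  coeff-+T []      b       i       = sym (+-identityˡ _)
  coeff-+T (x ∷ a) []      i       = sym (+-identityʳ _)
  coeff-+T (x ∷ a) (y ∷ b) zero    = refl
  coeff-+T (x ∷ a) (y ∷ b) (suc i) = coeff-+T a b i

  coeff-scaleT : ∀ x a i → coeffT (scaleT x a) i ≈ x * coeffT a i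
  coeff-scaleT x []      i       = sym (zeroʳ x)
  coeff-scaleT x (y ∷ a) zero    = refl
  coeff-scaleT x (y ∷ a) (suc i) = coeff-scaleT x a i

  coeff--T : ∀ a i → coeffT (-T a) i ≈ - coeffT a i
  coeff--T a i = trans (coeff-scaleT (- 1#) a i) (-1*x≈-x _)

  module _ where
    open import Relation.Binary.Reasoning.Setoid setoid

    +T-cong : ∀ {a a′ b b′} → a ≋ a′ → b ≋ b′ → (a +T b) ≋ (a′ +T b′)
    +T-cong {a} {a′} {b} {b′} (coeffwise e) (coeffwise e′) = coeffwise λ i → begin
      coeffT (a +T b) i        ≈⟨ coeff-+T a b i ⟩
      coeffT a i + coeffT b i  ≈⟨ +-cong (e i) (e′ i) ⟩
      coeffT a′ i + coeffT b′ i ≈⟨ coeff-+T a′ b′ i ⟨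
      coeffT (a′ +T b′) i      ∎

    scaleT-cong : ∀ {x y a b} → x ≈ y → a ≋ b → scaleT x a ≋ scaleT y b
    scaleT-cong {x} {y} {a} {b} x≈y (coeffwise e) = coeffwise λ i → begin
      coeffT (scaleT x a) i ≈⟨ coeff-scaleT x a i ⟩
      x * coeffT a i        ≈⟨ *-cong x≈y (e i) ⟩
      y * coeffT b i        ≈⟨ coeff-scaleT y b i ⟨
      coeffT (scaleT y b) i ∎

    -T-cong : ∀ {a b} → a ≋ b → (-T a) ≋ (-T b)
    -T-cong = scaleT-cong refl

    +T-assoc : ∀ a b c → ((a +T b) +T c) ≋ (a +T (b +T c))
    +T-assoc a b c = coeffwise λ i → begin
      coeffT ((a +T b) +T c) i                 ≈⟨ trans (coeff-+T (a +T b) c i) (+-congʳ (coeff-+T a b i)) ⟩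
      (coeffT a i + coeffT b i) + coeffT c i   ≈⟨ +-assoc _ _ _ ⟩
      coeffT a i + (coeffT b i + coeffT c i)   ≈⟨ trans (coeff-+T a (b +T c) i) (+-congˡ (coeff-+T b c i)) ⟨
      coeffT (a +T (b +T c)) i                 ∎

    +T-comm : ∀ a b → (a +T b) ≋ (b +T a)
    +T-comm a b = coeffwise λ i → begin
      coeffT (a +T b) i       ≈⟨ coeff-+T a b i ⟩
      coeffT a i + coeffT b i ≈⟨ +-comm _ _ ⟩
      coeffT b i + coeffT a i ≈⟨ coeff-+T b a i ⟨
      coeffT (b +T a) i       ∎

    +T-identityˡ : ∀ a → ([] +T a) ≋ a
    +T-identityˡ a = ≋-refl

    -T-inverseˡ : ∀ a → ((-T a) +T a) ≋ []
    -T-inverseˡ a = coeffwise λ i → begin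
      coeffT ((-T a) +T a) i    ≈⟨ trans (coeff-+T (-T a) a i) (+-congʳ (coeff--T a i)) ⟩
      - coeffT a i + coeffT a i ≈⟨ -‿inverseˡ _ ⟩
      0#                        ∎

    scaleT-distribˡ : ∀ x a b → scaleT x (a +T b) ≋ (scaleT x a +T scaleT x b)
    scaleT-distribˡ x a b = coeffwise λ i → begin
      coeffT (scaleT x (a +T b)) i        ≈⟨ trans (coeff-scaleT x (a +T b) i) (*-congˡ (coeff-+T a b i)) ⟩
      x * (coeffT a i + coeffT b i)       ≈⟨ distribˡ x _ _ ⟩
      x * coeffT a i + x * coeffT b i     ≈⟨ +-cong (coeff-scaleT x a i) (coeff-scaleT x b i) ⟨
      coeffT (scaleT x a) i + coeffT (scaleT x b) i ≈⟨ coeff-+T (scaleT x a) (scaleT x b) i ⟨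
      coeffT (scaleT x a +T scaleT x b) i ∎

    scaleT-zero : ∀ a → scaleT 0# a ≋ []
    scaleT-zero a = coeffwise λ i → trans (coeff-scaleT 0# a i) (zeroˡ _)

    scaleT-one : ∀ a → scaleT 1# a ≋ a
    scaleT-one a = coeffwise λ i → trans (coeff-scaleT 1# a i) (*-identityˡ _)

    shift-+T : ∀ a b → (0# ∷ (a +T b)) ≋ ((0# ∷ a) +T (0# ∷ b))
    shift-+T a b = ∷-cong (sym (+-identityʳ 0#)) ≋-refl

    scaleT-assoc : ∀ x y a → scaleT (x * y) a ≋ scaleT x (scaleT y a)
    scaleT-assoc x y a = coeffwise λ i → begin
      coeffT (scaleT (x * y) a) i   ≈⟨ coeff-scaleT (x * y) a i ⟩
      (x * y) * coeffT a i          ≈⟨ *-assoc x y _ ⟩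
      x * (y * coeffT a i)          ≈⟨ trans (coeff-scaleT x (scaleT y a) i) (*-congˡ (coeff-scaleT y a i)) ⟨
      coeffT (scaleT x (scaleT y a)) i ∎

    scaleT-shift : ∀ x a → scaleT x (0# ∷ a) ≋ (0# ∷ scaleT x a)
    scaleT-shift x a = ∷-cong (zeroʳ x) ≋-refl

  +T-middleFour : ∀ a b c d → ((a +T b) +T (c +T d)) ≋ ((a +T c) +T (b +T d))
  +T-middleFour = Consequences.comm∧assoc⇒middleFour ≋-setoid +T-cong +T-comm +T-assoc

  +T-identityʳ : ∀ a → (a +T []) ≋ a
  +T-identityʳ a = ≋-trans (+T-comm a []) ≋-refl

  *T-zeroʳ : ∀ a → (a *T []) ≋ []
  *T-zeroʳ []      = ≋-refl
  *T-zeroʳ (x ∷ a) = ≋[]-∷ refl (*T-zeroʳ a)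

  *T-zeroˡ-≋ : ∀ {a} b → a ≋ [] → (a *T b) ≋ []
  *T-zeroˡ-≋ {[]}    b a≋0 = ≋-refl
  *T-zeroˡ-≋ {x ∷ a} b a≋0 with ∷-≋[] a≋0
  ... | x≈0 , a≋0′ = ≋-trans (+T-cong (≋-trans (scaleT-cong x≈0 ≋-refl) (scaleT-zero b))
                                      (≋[]-∷ refl (*T-zeroˡ-≋ b a≋0′)))
                             ≋-refl

  *T-congˡ : ∀ {a a′} b → a ≋ a′ → (a *T b) ≋ (a′ *T b)
  *T-congˡ {[]}    {a′}     b e = ≋-sym (*T-zeroˡ-≋ b (≋-sym e))
  *T-congˡ {x ∷ a} {[]}     b e = *T-zeroˡ-≋ b e
  *T-congˡ {x ∷ a} {y ∷ a′} b e with ∷-injective e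
  ... | x≈y , a≋a′ = +T-cong (scaleT-cong x≈y ≋-refl) (∷-cong refl (*T-congˡ b a≋a′))

  *T-congʳ : ∀ a {b b′} → b ≋ b′ → (a *T b) ≋ (a *T b′)
  *T-congʳ []      e = ≋-refl
  *T-congʳ (x ∷ a) e = +T-cong (scaleT-cong refl e) (∷-cong refl (*T-congʳ a e))

  *T-cong : ∀ {a a′ b b′} → a ≋ a′ → b ≋ b′ → (a *T b) ≋ (a′ *T b′)
  *T-cong {a} {a′} {b} e e′ = ≋-trans (*T-congˡ b e) (*T-congʳ a′ e′)

  *T-distribˡ : ∀ a b c → (a *T (b +T c)) ≋ ((a *T b) +T (a *T c))
  *T-distribˡ []      b c = ≋-refl
  *T-distribˡ (x ∷ a) b c =
    ≋-trans (+T-cong (scaleT-distribˡ x b c) (≋-trans (∷-cong refl (*T-distribˡ a b c)) (shift-+T (a *T b) (a *T c))))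
            (+T-middleFour (scaleT x b) (scaleT x c) (0# ∷ (a *T b)) (0# ∷ (a *T c)))

  scaleT-*T : ∀ x b c → (scaleT x b *T c) ≋ scaleT x (b *T c)
  scaleT-*T x []      c = ≋-refl
  scaleT-*T x (y ∷ b) c =
    ≋-trans (+T-cong (scaleT-assoc x y c) (≋-trans (∷-cong refl (scaleT-*T x b c)) (≋-sym (scaleT-shift x (b *T c)))))
            (≋-sym (scaleT-distribˡ x (scaleT y c) (0# ∷ (b *T c))))

  shift-*T : ∀ a c → ((0# ∷ a) *T c) ≋ (0# ∷ (a *T c))
  shift-*T a c = +T-cong (scaleT-zero c) ≋-refl

  *T-shiftʳ : ∀ b a → (b *T (0# ∷ a)) ≋ (0# ∷ (b *T a))
  *T-shiftʳ []      a = ≋-sym (≋[]-∷ refl ≋-refl)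
  *T-shiftʳ (y ∷ b) a =
    ≋-trans (+T-cong (scaleT-shift y a) (∷-cong refl (*T-shiftʳ b a)))
            (≋-sym (shift-+T (scaleT y a) (0# ∷ (b *T a))))

  *T-singletonʳ : ∀ b x → (b *T (x ∷ [])) ≋ scaleT x b
  *T-singletonʳ []      x = ≋-refl
  *T-singletonʳ (y ∷ b) x = ∷-cong (trans (+-identityʳ _) (*-comm y x)) (*T-singletonʳ b x)

  *T-comm : ∀ a b → (a *T b) ≋ (b *T a)
  *T-comm []      b = ≋-sym (*T-zeroʳ b)
  *T-comm (x ∷ a) b = begin
    scaleT x b +T (0# ∷ (a *T b))       ≈⟨ +T-cong (≋-sym (*T-singletonʳ b x)) (∷-cong refl (*T-comm a b)) ⟩
    (b *T (x ∷ [])) +T (0# ∷ (b *T a))  ≈⟨ +T-cong ≋-refl (≋-sym (*T-shiftʳ b a)) ⟩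
    (b *T (x ∷ [])) +T (b *T (0# ∷ a))  ≈⟨ *T-distribˡ b (x ∷ []) (0# ∷ a) ⟨
    b *T ((x + 0#) ∷ a)                 ≈⟨ *T-congʳ b (∷-cong (+-identityʳ x) ≋-refl) ⟩
    b *T (x ∷ a)                        ∎
    where open import Relation.Binary.Reasoning.Setoid ≋-setoid

  *T-distribʳ : ∀ c a b → ((a +T b) *T c) ≋ ((a *T c) +T (b *T c))
  *T-distribʳ c a b = ≋-trans (*T-comm (a +T b) c)
    (≋-trans (*T-distribˡ c a b) (+T-cong (*T-comm c a) (*T-comm c b)))

  *T-assoc : ∀ a b c → ((a *T b) *T c) ≋ (a *T (b *T c))
  *T-assoc []      b c = ≋-refl
  *T-assoc (x ∷ a) b c =
    ≋-trans (*T-distribʳ c (scaleT x b) (0# ∷ (a *T b)))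
            (+T-cong (scaleT-*T x b c) (≋-trans (shift-*T (a *T b) c) (∷-cong refl (*T-assoc a b c))))

  *T-identityˡ : ∀ a → (oneT *T a) ≋ a
  *T-identityˡ a = ≋-trans (+T-cong (scaleT-one a) (≋[]-∷ refl ≋-refl)) (+T-identityʳ a)

  commutativeRing : CommutativeRing 0ℓ 0ℓ
  commutativeRing = record
    { Carrier = PolyT ; _≈_ = _≋_ ; _+_ = _+T_ ; _*_ = _*T_ ; -_ = -T_ ; 0# = [] ; 1# = oneT
    ; isCommutativeRing = record
      { isRing = record
        { +-isAbelianGroup = record
          { isGroup = record
            { isMonoid = record
              { isSemigroup = record
                { isMagma = record { isEquivalence = Setoid.isEquivalence ≋-setoid ; ∙-cong = +T-cong }
                ; assoc = +T-assoc }
              ; identity = +T-identityˡ , +T-identityʳ }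
            ; inverse = Consequences.comm∧invˡ⇒inv ≋-setoid +T-comm -T-inverseˡ
            ; ⁻¹-cong = -T-cong }
          ; comm = +T-comm }
        ; *-cong = *T-cong
        ; *-assoc = *T-assoc
        ; *-identity = Consequences.comm∧idˡ⇒id ≋-setoid *T-comm *T-identityˡ
        ; distrib = *T-distribˡ , *T-distribʳ }
      ; *-comm = *T-comm } }

  module _ (_≟_ : Decidable _≈_) where

    ≋[]? : ∀ a → Dec (a ≋ [])
    ≋[]? []      = yes ≋-refl
    ≋[]? (x ∷ a) with x ≟ 0# | ≋[]? a
    ... | yes x≈0 | yes a≋0 = yes (≋[]-∷ x≈0 a≋0)
    ... | no  x≉0 | _       = no λ e → x≉0 (proj₁ (∷-≋[] e))
    ... | _       | no  a≉0 = no λ e → a≉0 (proj₂ (∷-≋[] e))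

    leading-coefficient : ∀ a → ¬ a ≋ [] → Σ (List A) λ low → Σ A λ c → ¬ c ≈ 0# × a ≋ (low ++ c ∷ [])
    leading-coefficient []      a≉0 = contradiction ≋-refl a≉0
    leading-coefficient (x ∷ a) x∷a≉0 with ≋[]? a
    ... | yes a≋0 = [] , x , (λ x≈0 → x∷a≉0 (≋[]-∷ x≈0 a≋0)) , ∷-cong refl a≋0
    ... | no  a≉0 with leading-coefficient a a≉0
    ...   | low , c , c≉0 , a≋low∷c = x ∷ low , c , c≉0 , ∷-cong refl a≋low∷c

  module _ (zero-divisor : ∀ {x y} → x * y ≈ 0# → x ≈ 0# ⊎ y ≈ 0#) where

    *T-zero-divisor : ∀ a b → (a *T b) ≋ [] → a ≋ [] ⊎ b ≋ []
    *T-zero-divisor []      b       ab≋0 = inj₁ ≋-refl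
    *T-zero-divisor (x ∷ a) []      ab≋0 = inj₂ ≋-refl
    *T-zero-divisor (x ∷ a) (y ∷ b) ab≋0 =
      [ (λ x≈0 → Sum.map₁ (≋[]-∷ x≈0) (*T-zero-divisor a (y ∷ b) (divide-by-tˡ x≈0)))
      , (λ y≈0 → Sum.map₂ (≋[]-∷ y≈0) (*T-zero-divisor (x ∷ a) b (divide-by-tʳ y≈0)))
      ]′ (zero-divisor (trans (sym (+-identityʳ _)) (proj₁ (∷-≋[] ab≋0))))
      where
      -- x * y is the constant coefficient of the product, so one factor is divisible by t.
      divide-by-tˡ : x ≈ 0# → (a *T (y ∷ b)) ≋ []
      divide-by-tˡ x≈0 = proj₂ (∷-≋[] (≋-trans (≋-sym (shift-*T a (y ∷ b)))
                                          (≋-trans (*T-congˡ (y ∷ b) (∷-cong (sym x≈0) (≋-refl {a}))) ab≋0)))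
      divide-by-tʳ : y ≈ 0# → ((x ∷ a) *T b) ≋ []
      divide-by-tʳ y≈0 = proj₂ (∷-≋[] (≋-trans (≋-sym (*T-shiftʳ (x ∷ a) b))
                                          (≋-trans (*T-congʳ (x ∷ a) (∷-cong (sym y≈0) (≋-refl {b}))) ab≋0)))

  zipWithU : (PolyT → PolyT → PolyT) → PolyTU → PolyTU → PolyTU
  zipWithU _∙_ []      []      = []
  zipWithU _∙_ (x ∷ f) []      = (x ∙ []) ∷ zipWithU _∙_ f []
  zipWithU _∙_ []      (y ∷ g) = ([] ∙ y) ∷ zipWithU _∙_ [] g
  zipWithU _∙_ (x ∷ f) (y ∷ g) = (x ∙ y) ∷ zipWithU _∙_ f g

  coeffU-zipWithU : ∀ {_∙_} → ([] ∙ []) ≋ [] →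
                    ∀ f g r → coeffU (zipWithU _∙_ f g) r ≋ (coeffU f r ∙ coeffU g r)
  coeffU-zipWithU []∙[]≋[] []      []      r       = ≋-sym []∙[]≋[]
  coeffU-zipWithU []∙[]≋[] (x ∷ f) []      zero    = ≋-refl
  coeffU-zipWithU []∙[]≋[] (x ∷ f) []      (suc r) = coeffU-zipWithU []∙[]≋[] f [] r
  coeffU-zipWithU []∙[]≋[] []      (y ∷ g) zero    = ≋-refl
  coeffU-zipWithU []∙[]≋[] []      (y ∷ g) (suc r) = coeffU-zipWithU []∙[]≋[] [] g r
  coeffU-zipWithU []∙[]≋[] (x ∷ f) (y ∷ g) zero    = ≋-refl
  coeffU-zipWithU []∙[]≋[] (x ∷ f) (y ∷ g) (suc r) = coeffU-zipWithU []∙[]≋[] f g r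

  linCombU : PolyT → PolyTU → PolyT → PolyTU → PolyTU
  linCombU a f b g = zipWithU (λ x y → (a *T x) +T (b *T y)) f g

  coeffU-linCombU : ∀ a f b g r → coeffU (linCombU a f b g) r ≋ ((a *T coeffU f r) +T (b *T coeffU g r))
  coeffU-linCombU a f b g = coeffU-zipWithU (+T-cong (*T-zeroʳ a) (*T-zeroʳ b)) f g

module PolynomialSums (R : CommutativeRing 0ℓ 0ℓ) where

  open import Data.Nat using (zero; suc)
  open import Data.List using ([])
  open import Data.Fin as Fin using (Fin)
  open import Function using (_∘_)
  open import Relation.Binary.PropositionalEquality as ≡ using (_≢_)

  open CommutativeRing R renaming (Carrier to A) hiding (zero)
  open Over R
  open Polynomials R

  private
    module ΣR = FiniteSums +-commutativeMonoid
    module ΣT = FiniteSums (CommutativeRing.+-commutativeMonoid commutativeRing)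
    module ΣT* = SemiringSums (CommutativeRing.semiring commutativeRing)

  sumT≡sum : ∀ {n} (f : Fin n → PolyT) → sumT f ≡ ΣT.sum f
  sumT≡sum {zero}  f = ≡.refl
  sumT≡sum {suc n} f = ≡.cong (f Fin.zero +T_) (sumT≡sum (λ j → f (Fin.suc j)))

  sumA≡sum : ∀ {n} (f : Fin n → A) → sumA f ≡ ΣR.sum f
  sumA≡sum {zero}  f = ≡.refl
  sumA≡sum {suc n} f = ≡.cong (f Fin.zero +_) (sumA≡sum (λ j → f (Fin.suc j)))

  sumT-cong : ∀ {n} {f g : Fin n → PolyT} → (∀ k → f k ≋ g k) → sumT f ≋ sumT g
  sumT-cong {zero}  f≋g = ≋-refl
  sumT-cong {suc n} f≋g = +T-cong (f≋g Fin.zero) (sumT-cong (f≋g ∘ Fin.suc))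

  sumT-≋[] : ∀ {n} {f : Fin n → PolyT} → (∀ k → f k ≋ []) → sumT f ≋ []
  sumT-≋[] {zero}  f≋0 = ≋-refl
  sumT-≋[] {suc n} f≋0 = +T-cong (f≋0 Fin.zero) (sumT-≋[] (f≋0 ∘ Fin.suc))

  sumT-single : ∀ {n} {f : Fin n → PolyT} i → (∀ k → k ≢ i → f k ≋ []) → sumT f ≋ f i
  sumT-single {f = f} i f≋0 = ≡.subst (_≋ f i) (≡.sym (sumT≡sum f)) (ΣT.sum-single i f≋0)

  sumT-cong-except₂ : ∀ {n} {f g : Fin n → PolyT} i j → i ≢ j → (∀ k → k ≢ i → k ≢ j → f k ≋ g k) →
                      (f i +T f j) ≋ (g i +T g j) → sumT f ≋ sumT g
  sumT-cong-except₂ {f = f} {g} i j i≢j f≋g pair =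
    ≡.subst₂ _≋_ (≡.sym (sumT≡sum f)) (≡.sym (sumT≡sum g)) (ΣT.sum-cong-except₂ i j i≢j f≋g pair)

  sumA-cong-except₂ : ∀ {n} {f g : Fin n → A} i j → i ≢ j → (∀ k → k ≢ i → k ≢ j → f k ≈ g k) →
                      f i + f j ≈ g i + g j → sumA f ≈ sumA g
  sumA-cong-except₂ {f = f} {g} i j i≢j f≈g pair =
    ≡.subst₂ _≈_ (≡.sym (sumA≡sum f)) (≡.sym (sumA≡sum g)) (ΣR.sum-cong-except₂ i j i≢j f≈g pair)

  sumT-*-+-* : ∀ {n} x y (u v w : Fin n → PolyT) →
               sumT (λ k → ((x *T u k) +T (y *T v k)) *T w k)
               ≋ ((x *T sumT (λ k → u k *T w k)) +T (y *T sumT (λ k → v k *T w k)))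
  sumT-*-+-* x y u v w = ≡.subst₂ _≋_ (≡.sym (sumT≡sum (λ k → ((x *T u k) +T (y *T v k)) *T w k)))
    (≡.cong₂ (λ s s′ → (x *T s) +T (y *T s′)) (≡.sym (sumT≡sum (λ k → u k *T w k)))
                                              (≡.sym (sumT≡sum (λ k → v k *T w k))))
    (ΣT*.sum-*-+-* x y u v w)

module LaurentSeries (R : CommutativeRing 0ℓ 0ℓ) where

  open import Data.Nat as ℕ using (zero; suc; z<s; s<s)
  import Data.Nat.Properties as ℕ
  open import Data.Integer as ℤ using (+_)
  import Data.Integer.Properties as ℤ
  open import Data.List using ([]; _∷_; _++_; length)
  open import Data.Product using (_,_; proj₁; proj₂)
  open import Function using (_∘_)
  open import Relation.Nullary using (yes; no; contradiction)
  open import Relation.Binary.Definitions using (Decidable)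
  import Relation.Binary.PropositionalEquality as ≡

  open CommutativeRing R renaming (Carrier to A) hiding (zero)
  open Over R
  open Polynomials R
  open IndexArithmetic
  open import Relation.Binary.Reasoning.Setoid setoid
  open import Algebra.Solver.Ring.NaturalCoefficients.Default commutativeSemiring
  open import Algebra.Properties.AbelianGroup +-abelianGroup using (xyx⁻¹≈y)
  open import Algebra.Properties.CommutativeSemigroup +-commutativeSemigroup
    using () renaming (interchange to +-interchange)

  private
    pred : ℤ → ℤ
    pred n = n ℤ.- + 1

  mulLT-local : ∀ {γ δ} a n → (∀ k → k ℕ.< length a → γ (n ℤ.- + k) ≈ δ (n ℤ.- + k)) →
                mulLT γ a n ≈ mulLT δ a n
  mulLT-local         []      n γ≈δ = refl
  mulLT-local {γ} {δ} (x ∷ a) n γ≈δ = +-cong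
    (*-congʳ (≡.subst (λ m → γ m ≈ δ m) (ℤ.+-identityʳ n) (γ≈δ 0 z<s)))
    (mulLT-local a (pred n) λ k k<|a| →
       ≡.subst (λ m → γ m ≈ δ m) (≡.sym ([n-1]-k≡n-[1+k] n k)) (γ≈δ (suc k) (s<s k<|a|)))

  mulLT-congˡ : ∀ {γ δ} → (∀ m → γ m ≈ δ m) → ∀ a n → mulLT γ a n ≈ mulLT δ a n
  mulLT-congˡ γ≈δ a n = mulLT-local a n λ k _ → γ≈δ _

  mulLT-≋[] : ∀ γ {a} n → a ≋ [] → mulLT γ a n ≈ 0#
  mulLT-≋[] γ {[]}    n a≋0 = refl
  mulLT-≋[] γ {x ∷ a} n a≋0 = begin
    γ n * x + mulLT γ a (pred n)
      ≈⟨ +-cong (*-congˡ (proj₁ (∷-≋[] a≋0))) (mulLT-≋[] γ (pred n) (proj₂ (∷-≋[] a≋0))) ⟩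
    γ n * 0# + 0#
      ≈⟨ trans (+-identityʳ _) (zeroʳ _) ⟩
    0# ∎

  mulLT-congʳ : ∀ γ {a b} n → a ≋ b → mulLT γ a n ≈ mulLT γ b n
  mulLT-congʳ γ {[]}    {b}     n a≋b = sym (mulLT-≋[] γ n (≋-sym a≋b))
  mulLT-congʳ γ {x ∷ a} {[]}    n a≋b = mulLT-≋[] γ n a≋b
  mulLT-congʳ γ {x ∷ a} {y ∷ b} n a≋b =
    +-cong (*-congˡ (proj₁ (∷-injective a≋b))) (mulLT-congʳ γ (pred n) (proj₂ (∷-injective a≋b)))

  mulLT-zeroˡ : ∀ {γ} → (∀ m → γ m ≈ 0#) → ∀ a n → mulLT γ a n ≈ 0#
  mulLT-zeroˡ γ≈0 []      n = refl
  mulLT-zeroˡ {γ} γ≈0 (x ∷ a) n = begin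
    γ n * x + mulLT γ a (pred n) ≈⟨ +-cong (*-congʳ (γ≈0 n)) (mulLT-zeroˡ γ≈0 a (pred n)) ⟩
    0# * x + 0#                ≈⟨ trans (+-identityʳ _) (zeroˡ x) ⟩
    0#                         ∎

  mulLT-+T : ∀ γ a b n → mulLT γ (a +T b) n ≈ mulLT γ a n + mulLT γ b n
  mulLT-+T γ []      b       n = sym (+-identityˡ _)
  mulLT-+T γ (x ∷ a) []      n = sym (+-identityʳ _)
  mulLT-+T γ (x ∷ a) (y ∷ b) n = begin
    γ n * (x + y) + mulLT γ (a +T b) (pred n)
      ≈⟨ +-cong (distribˡ (γ n) x y) (mulLT-+T γ a b (pred n)) ⟩
    (γ n * x + γ n * y) + (mulLT γ a (pred n) + mulLT γ b (pred n))
      ≈⟨ +-interchange _ _ _ _ ⟩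
    (γ n * x + mulLT γ a (pred n)) + (γ n * y + mulLT γ b (pred n)) ∎

  mulLT-scaleT : ∀ γ x a n → mulLT γ (scaleT x a) n ≈ x * mulLT γ a n
  mulLT-scaleT γ x []      n = sym (zeroʳ x)
  mulLT-scaleT γ x (y ∷ a) n = begin
    γ n * (x * y) + mulLT γ (scaleT x a) (pred n)
      ≈⟨ +-congˡ (mulLT-scaleT γ x a (pred n)) ⟩
    γ n * (x * y) + x * mulLT γ a (pred n)
      ≈⟨ solve 4 (λ g x y m → g :* (x :* y) :+ x :* m := x :* (g :* y :+ m)) refl (γ n) x y _ ⟩
    x * (γ n * y + mulLT γ a (pred n)) ∎

  mulLT-+ˡ : ∀ γ δ a n → mulLT (λ m → γ m + δ m) a n ≈ mulLT γ a n + mulLT δ a n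
  mulLT-+ˡ γ δ []      n = sym (+-identityʳ 0#)
  mulLT-+ˡ γ δ (x ∷ a) n = begin
    (γ n + δ n) * x + mulLT (λ m → γ m + δ m) a (pred n)
      ≈⟨ +-cong (distribʳ x (γ n) (δ n)) (mulLT-+ˡ γ δ a (pred n)) ⟩
    (γ n * x + δ n * x) + (mulLT γ a (pred n) + mulLT δ a (pred n))
      ≈⟨ +-interchange _ _ _ _ ⟩
    (γ n * x + mulLT γ a (pred n)) + (δ n * x + mulLT δ a (pred n)) ∎

  mulLT-*ʳ : ∀ γ x a n → mulLT (λ m → γ m * x) a n ≈ mulLT γ a n * x
  mulLT-*ʳ γ x []      n = sym (zeroˡ x)
  mulLT-*ʳ γ x (y ∷ a) n = begin
    (γ n * x) * y + mulLT (λ m → γ m * x) a (pred n)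
      ≈⟨ +-congˡ (mulLT-*ʳ γ x a (pred n)) ⟩
    (γ n * x) * y + mulLT γ a (pred n) * x
      ≈⟨ solve 4 (λ g x y m → (g :* x) :* y :+ m :* x := (g :* y :+ m) :* x) refl (γ n) x y _ ⟩
    (γ n * y + mulLT γ a (pred n)) * x ∎

  mulLT-pred : ∀ γ b n → mulLT (γ ∘ pred) b n ≈ mulLT γ b (pred n)
  mulLT-pred γ []      n = refl
  mulLT-pred γ (y ∷ b) n = +-congˡ (mulLT-pred γ b (pred n))

  mulLT-*T : ∀ γ a b n → mulLT γ (a *T b) n ≈ mulLT (mulLT γ a) b n
  mulLT-*T γ []      b n = sym (mulLT-zeroˡ (λ _ → refl) b n)
  mulLT-*T γ (x ∷ a) b n = begin
    mulLT γ (scaleT x b +T (0# ∷ (a *T b))) n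
      ≈⟨ mulLT-+T γ (scaleT x b) (0# ∷ (a *T b)) n ⟩
    mulLT γ (scaleT x b) n + (γ n * 0# + mulLT γ (a *T b) (pred n))
      ≈⟨ +-cong (trans (mulLT-scaleT γ x b n) (*-comm _ _))
                (trans (+-congʳ (zeroʳ _)) (trans (+-identityˡ _) (mulLT-*T γ a b (pred n)))) ⟩
    mulLT γ b n * x + mulLT (mulLT γ a) b (pred n)
      ≈⟨ +-cong (mulLT-*ʳ γ x b n) (mulLT-pred (mulLT γ a) b n) ⟨
    mulLT (λ m → γ m * x) b n + mulLT (λ m → mulLT γ a (pred m)) b n
      ≈⟨ mulLT-+ˡ _ _ b n ⟨
    mulLT (mulLT γ (x ∷ a)) b n ∎

  mulLT-snoc : ∀ γ a c n → mulLT γ (a ++ c ∷ []) n ≈ mulLT γ a n + γ (n ℤ.- + length a) * c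
  mulLT-snoc γ []      c n = begin
    γ n * c + 0#           ≈⟨ +-identityʳ _ ⟩
    γ n * c                ≡⟨ ≡.cong (λ m → γ m * c) (ℤ.+-identityʳ n) ⟨
    γ (n ℤ.- + 0) * c      ≈⟨ +-identityˡ _ ⟨
    0# + γ (n ℤ.- + 0) * c ∎
  mulLT-snoc γ (x ∷ a) c n = begin
    γ n * x + mulLT γ (a ++ c ∷ []) (pred n)
      ≈⟨ +-congˡ (mulLT-snoc γ a c (pred n)) ⟩
    γ n * x + (mulLT γ a (pred n) + γ (pred n ℤ.- + length a) * c)
      ≈⟨ +-assoc _ _ _ ⟨
    (γ n * x + mulLT γ a (pred n)) + γ (pred n ℤ.- + length a) * c
      ≡⟨ ≡.cong (λ m → (γ n * x + mulLT γ a (pred n)) + γ m * c) ([n-1]-k≡n-[1+k] n (length a)) ⟩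
    (γ n * x + mulLT γ a (pred n)) + γ (n ℤ.- + suc (length a)) * c ∎

  mulLT-vanishes : ∀ {γ N} → (∀ m → N ℤ.< m → γ m ≈ 0#) →
                   ∀ a n → N ℤ.+ + length a ℤ.< n → mulLT γ a n ≈ 0#
  mulLT-vanishes         γ≈0 []      n _  = refl
  mulLT-vanishes {γ} {N} γ≈0 (x ∷ a) n lt = begin
    γ n * x + mulLT γ a (pred n) ≈⟨ +-cong (*-congʳ (γ≈0 n (N+[1+l]<n⇒N<n N (length a) lt)))
                                           (mulLT-vanishes γ≈0 a (pred n) (N+[1+l]<n⇒N+l<n-1 N (length a) lt)) ⟩
    0# * x + 0#                  ≈⟨ trans (+-identityʳ _) (zeroˡ x) ⟩
    0#                           ∎

  infixl 6 _+ᴸ_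
  _+ᴸ_ : Laurent → Laurent → Laurent
  α +ᴸ β = record
    { coeffL = λ m → coeffL α m + coeffL β m
    ; bound  = Nα ℤ.⊔ Nβ , λ m lt → trans (+-cong (proj₂ (bound α) m (ℤ.≤-<-trans (ℤ.i≤i⊔j Nα Nβ) lt))
                                                  (proj₂ (bound β) m (ℤ.≤-<-trans (ℤ.i≤j⊔i Nα Nβ) lt)))
                                           (+-identityʳ 0#) }
    where Nα = proj₁ (bound α)
          Nβ = proj₁ (bound β)

  infixl 7 _*ᴸ_
  _*ᴸ_ : Laurent → PolyT → Laurent
  α *ᴸ a = record
    { coeffL = mulLT (coeffL α) a
    ; bound  = proj₁ (bound α) ℤ.+ + length a , mulLT-vanishes (proj₂ (bound α)) a }

  module Division (χ : Laurent) (low : List A) (c c⁻¹ : A) (c*c⁻¹≈1 : c * c⁻¹ ≈ 1#) where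

    private
      d : ℕ
      d = length low
      N₀ : ℤ
      N₀ = proj₁ (bound χ) ℤ.- + d

    -- The quotient vanishes above N₀ and is determined from the top down; approx f runs f rounds
    -- of this recursion and is already correct at every m with N₀ < m + f.
    step : (ℤ → A) → ℤ → A
    step γ m with m ℤ.≤? N₀
    ... | yes _ = c⁻¹ * (coeffL χ (m ℤ.+ + d) - mulLT γ low (m ℤ.+ + d))
    ... | no  _ = 0#

    step-above : ∀ γ {m} → N₀ ℤ.< m → step γ m ≈ 0#
    step-above γ {m} N₀<m with m ℤ.≤? N₀
    ... | yes m≤N₀ = contradiction m≤N₀ (ℤ.<⇒≱ N₀<m)
    ... | no  _    = refl

    step-below : ∀ γ {m} → m ℤ.≤ N₀ → step γ m ≈ c⁻¹ * (coeffL χ (m ℤ.+ + d) - mulLT γ low (m ℤ.+ + d))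
    step-below γ {m} m≤N₀ with m ℤ.≤? N₀
    ... | yes _    = refl
    ... | no  m≰N₀ = contradiction m≤N₀ m≰N₀

    step-local : ∀ {γ δ} m → (∀ k → k ℕ.< d → γ ((m ℤ.+ + d) ℤ.- + k) ≈ δ ((m ℤ.+ + d) ℤ.- + k)) →
                 step γ m ≈ step δ m
    step-local m γ≈δ with m ℤ.≤? N₀
    ... | yes _ = *-congˡ (+-congˡ (-‿cong (mulLT-local low (m ℤ.+ + d) γ≈δ)))
    ... | no  _ = refl

    approx : ℕ → ℤ → A
    approx zero    _ = 0#
    approx (suc f)   = step (approx f)

    approx-above : ∀ f {m} → N₀ ℤ.< m → approx f m ≈ 0#
    approx-above zero    _    = refl
    approx-above (suc f) N₀<m = step-above (approx f) N₀<m

    approx-suc : ∀ f {m} → N₀ ℤ.< m ℤ.+ + f → approx f m ≈ approx (suc f) m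
    approx-suc zero    {m} lt = sym (step-above _ (≡.subst (N₀ ℤ.<_) (ℤ.+-identityʳ m) lt))
    approx-suc (suc f) {m} lt = step-local m λ k k<d → approx-suc f (N<m+[1+f]⇒N<[m+d]-k+f m f k<d lt)

    approx-stable : ∀ f e {m} → N₀ ℤ.< m ℤ.+ + f → approx f m ≈ approx (f ℕ.+ e) m
    approx-stable f zero    {m} lt = reflexive (≡.cong (λ g → approx g m) (≡.sym (ℕ.+-identityʳ f)))
    approx-stable f (suc e) {m} lt = begin
      approx f m               ≈⟨ approx-stable f e lt ⟩
      approx (f ℕ.+ e) m       ≈⟨ approx-suc (f ℕ.+ e) (N<m+f⇒N<m+[f+e] m f e lt) ⟩
      approx (suc f ℕ.+ e) m   ≡⟨ ≡.cong (λ g → approx g m) (ℕ.+-suc f e) ⟨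
      approx (f ℕ.+ suc e) m   ∎

    quotient : ℤ → A
    quotient m = approx (suc ℤ.∣ N₀ ℤ.- m ∣) m

    quotient≈approx : ∀ f {m} → N₀ ℤ.< m ℤ.+ + f → quotient m ≈ approx f m
    quotient≈approx f {m} lt = begin
      approx F m           ≈⟨ approx-stable F f {m} (j<i+[1+∣j-i∣] m N₀) ⟩
      approx (F ℕ.+ f) m   ≡⟨ ≡.cong (λ g → approx g m) (ℕ.+-comm F f) ⟩
      approx (f ℕ.+ F) m   ≈⟨ approx-stable f F {m} lt ⟨
      approx f m           ∎
      where F = suc ℤ.∣ N₀ ℤ.- m ∣

    quotient-above : ∀ {m} → N₀ ℤ.< m → quotient m ≈ 0#
    quotient-above {m} = approx-above (suc ℤ.∣ N₀ ℤ.- m ∣)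

    quotient-divides : ∀ n → mulLT quotient (low ++ c ∷ []) n ≈ coeffL χ n
    quotient-divides n with n ℤ.- + d ℤ.≤? N₀
    ... | yes m₀≤N₀ = begin
      mulLT quotient (low ++ c ∷ []) n
        ≈⟨ mulLT-snoc quotient low c n ⟩
      mulLT quotient low n + quotient m₀ * c
        ≈⟨ +-cong (mulLT-local low n window) (*-congʳ (step-below (approx f) m₀≤N₀)) ⟩
      M + (c⁻¹ * (coeffL χ (m₀ ℤ.+ + d) - mulLT (approx f) low (m₀ ℤ.+ + d))) * c
        ≡⟨ ≡.cong (λ m → M + (c⁻¹ * (coeffL χ m - mulLT (approx f) low m)) * c) ([n-d]+d≡n n d) ⟩
      M + (c⁻¹ * (coeffL χ n - M)) * c
        ≈⟨ +-congˡ (solve 3 (λ u Y c → (u :* Y) :* c := (c :* u) :* Y) refl c⁻¹ _ c) ⟩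
      M + (c * c⁻¹) * (coeffL χ n - M)
        ≈⟨ +-congˡ (trans (*-congʳ c*c⁻¹≈1) (*-identityˡ _)) ⟩
      M + (coeffL χ n - M)
        ≈⟨ +-assoc M (coeffL χ n) (- M) ⟨
      M + coeffL χ n - M
        ≈⟨ xyx⁻¹≈y M (coeffL χ n) ⟩
      coeffL χ n ∎
      where
      m₀ = n ℤ.- + d
      f = ℤ.∣ N₀ ℤ.- m₀ ∣
      M = mulLT (approx f) low n
      window : ∀ k → k ℕ.< d → quotient (n ℤ.- + k) ≈ approx f (n ℤ.- + k)
      window k k<d = quotient≈approx f (≡.subst (λ m → N₀ ℤ.< (m ℤ.- + k) ℤ.+ + f) ([n-d]+d≡n n d)
                       (N<m+[1+f]⇒N<[m+d]-k+f m₀ f k<d (j<i+[1+∣j-i∣] m₀ N₀)))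
    ... | no m₀≰N₀ = begin
      mulLT quotient (low ++ c ∷ []) n
        ≈⟨ mulLT-snoc quotient low c n ⟩
      mulLT quotient low n + quotient (n ℤ.- + d) * c
        ≈⟨ +-cong (mulLT-local low n window) (*-congʳ (quotient-above N₀<m₀)) ⟩
      mulLT (λ _ → 0#) low n + 0# * c
        ≈⟨ +-cong (mulLT-zeroˡ (λ _ → refl) low n) (zeroˡ c) ⟩
      0# + 0#
        ≈⟨ +-identityʳ 0# ⟩
      0#
        ≈⟨ proj₂ (bound χ) n (N-d<n-d⇒N<n d N₀<m₀) ⟨
      coeffL χ n ∎
      where
      N₀<m₀ = ℤ.≰⇒> m₀≰N₀
      window : ∀ k → k ℕ.< d → quotient (n ℤ.- + k) ≈ 0#
      window k k<d = quotient-above (ℤ.<-trans N₀<m₀ (n-d<n-k n k<d))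

  module _ (_≟_ : Decidable _≈_) (isField : IsField) where

    divide : (χ : Laurent) (a : PolyT) → ¬ a ≋ [] → Σ Laurent λ y → ∀ n → mulLT (coeffL y) a n ≈ coeffL χ n
    divide χ a a≉0 with leading-coefficient _≟_ a a≉0
    ... | low , c , c≉0 , a≋low∷c with proj₂ isField c c≉0
    ...   | c⁻¹ , c*c⁻¹≈1 = record { coeffL = quotient ; bound = _ , λ _ → quotient-above } ,
                            λ n → trans (mulLT-congʳ quotient n a≋low∷c) (quotient-divides n)
      where open Division χ low c c⁻¹ c*c⁻¹≈1

module FiniteFields (F : CommutativeRing 0ℓ 0ℓ) where

  import Data.Fin.Properties as Fin
  open import Data.Product using (_,_; proj₂)
  open import Data.Sum using (_⊎_; inj₁; inj₂)
  open import Relation.Nullary using (yes; no)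
  open import Relation.Binary.Definitions using (Decidable)
  open import Relation.Binary.PropositionalEquality using (refl)

  open CommutativeRing F
  open Over F
  open import Relation.Binary.Reasoning.Setoid setoid

  HasCard⇒Decidable : ∀ {q} → HasCard q → Decidable _≈_
  HasCard⇒Decidable (e , onto , injective) x y with onto x | onto y
  ... | i , eᵢ≈x | j , eⱼ≈y with i Fin.≟ j
  ...   | yes refl = yes (trans (sym eᵢ≈x) eⱼ≈y)
  ...   | no  i≢j  = no λ x≈y → i≢j (injective i j (trans eᵢ≈x (trans x≈y (sym eⱼ≈y))))

  isField⇒noZeroDivisors : Decidable _≈_ → IsField → ∀ {x y} → x * y ≈ 0# → x ≈ 0# ⊎ y ≈ 0#
  isField⇒noZeroDivisors _≟_ isField {x} {y} xy≈0 with x ≟ 0#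
  ... | yes x≈0 = inj₁ x≈0
  ... | no  x≉0 with proj₂ isField x x≉0
  ...   | x⁻¹ , x*x⁻¹≈1 = inj₂ (begin
    y               ≈⟨ *-identityˡ y ⟨
    1# * y          ≈⟨ *-congʳ (trans (sym x*x⁻¹≈1) (*-comm x x⁻¹)) ⟩
    (x⁻¹ * x) * y   ≈⟨ *-assoc x⁻¹ x y ⟩
    x⁻¹ * (x * y)   ≈⟨ *-congˡ xy≈0 ⟩
    x⁻¹ * 0#        ≈⟨ zeroʳ x⁻¹ ⟩
    0#              ∎)

module Elimination (F : CommutativeRing 0ℓ 0ℓ) (_≟_ : Decidable (CommutativeRing._≈_ F)) (isField : Over.IsField F)
                   (p : ℕ) (1<p : 1 Data.Nat.< p) (K : List ℕ)
                   {L : ℕ} (h : Fin L → Over.PolyTU F) (β : Fin L → Over.Laurent F) where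

  open import Data.Fin as Fin using ()
  open import Data.Vec.Functional using (updateAt)
  open import Data.Vec.Functional.Properties using (updateAt-updates; updateAt-minimal)
  open import Data.List using ([]; _∷_; allFin)
  open import Data.List.Membership.Propositional using (_∈_; find; lose)
  open import Data.List.Membership.Propositional.Properties using (∈-allFin)
  open import Data.List.Relation.Unary.Any using (any?; here; there)
  open import Data.List.Relation.Unary.All as All using (All)
  open import Data.List.Relation.Unary.Unique.Propositional using (Unique; []; _∷_)
  open import Data.Product using (_,_; proj₁; proj₂)
  open import Data.Sum using (inj₁; inj₂)
  open import Function using (_∘_)
  open import Relation.Nullary using (yes; no; ¬?; contradiction)
  open import Relation.Nullary.Decidable using (_×-dec_; decidable-stable)
  open import Relation.Binary.Definitions using (Decidable)
  open import Relation.Binary.PropositionalEquality as ≡ using (_≢_)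

  open CommutativeRing F renaming (Carrier to A) hiding (zero)
  open Over F
  open Polynomials F
  open PolynomialSums F
  open LaurentSeries F
  open FiniteFields F using (isField⇒noZeroDivisors)
  open StarIndices using (KStar?)
  private
    module T = CommutativeRing commutativeRing
    open import Algebra.Properties.Ring T.ring using () renaming (-‿distribˡ-* to -T‿distribˡ-*T)
    import Algebra.Solver.Ring.NaturalCoefficients.Default as Solver
    module TSolver = Solver T.commutativeSemiring
    open import Algebra.Properties.CommutativeSemigroup +-commutativeSemigroup
      using () renaming (interchange to +-interchange)

  Independent : (Fin L → PolyTU) → Set
  Independent g = ∀ (c : Fin L → PolyT) →
    (∀ r → KStar p K r → sumT (λ j → c j *T coeffU (g j) r) ≋ []) → ∀ j → c j ≋ []

  unit : Fin L → Fin L → PolyT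
  unit i = updateAt (λ _ → []) i (λ _ → oneT)

  sum-unit : ∀ i (X : Fin L → PolyT) → sumT (λ j → unit i j *T X j) ≋ X i
  sum-unit i X = ≋-trans (sumT-single i unit-vanishes)
                         (≋-trans (*T-congˡ (X i) (≋-reflexive (updateAt-updates i (λ _ → []))))
                                  (*T-identityˡ (X i)))
    where unit-vanishes : ∀ j → j ≢ i → (unit i j *T X j) ≋ []
          unit-vanishes j j≢i = ≋-reflexive (≡.cong (_*T X j) (updateAt-minimal j i (λ _ → []) j≢i))

  record Reduction : Set where
    field
      𝒯 : Fin L → Fin L → PolyT
      g : Fin L → PolyTU
      γ : Fin L → Laurent
      g≋𝒯h : ∀ j r → sumT (λ k → 𝒯 j k *T coeffU (h k) r) ≋ coeffU (g j) r
      βh≈γg : ∀ r n → linCombCoeff β h r n ≈ linCombCoeff γ g r n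
      independent : Independent g

  module RowOperation (𝓡 : Reduction) {i M : Fin L} (i≢M : i ≢ M) (a b : PolyT) (a≉0 : ¬ a ≋ []) where

    open Reduction 𝓡

    y : Laurent
    y = proj₁ (divide _≟_ isField (γ i) a a≉0)

    y*a≈γᵢ : ∀ n → mulLT (coeffL y) a n ≈ coeffL (γ i) n
    y*a≈γᵢ = proj₂ (divide _≟_ isField (γ i) a a≉0)

    combineRow : (Fin L → PolyT) → Fin L → PolyT
    combineRow row k = (a *T row k) +T (b *T 𝒯 M k)

    𝒯′ : Fin L → Fin L → PolyT
    𝒯′ = updateAt 𝒯 i combineRow

    combineU : PolyTU → PolyTU
    combineU gᵢ = linCombU a gᵢ b (g M)

    g′ : Fin L → PolyTU
    g′ = updateAt g i combineU

    -- Since y·a = γᵢ, we have y·g′ᵢ + (γ_M − y·b)·g_M = γᵢ·gᵢ + γ_M·g_M.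
    γ′ : Fin L → Laurent
    γ′ = updateAt (updateAt γ M (λ γ_M → γ_M +ᴸ y *ᴸ (-T b))) i (λ _ → y)

    g′-updated : ∀ r → coeffU (g′ i) r ≋ ((a *T coeffU (g i) r) +T (b *T coeffU (g M) r))
    g′-updated r = ≡.subst (λ G → coeffU G r ≋ ((a *T coeffU (g i) r) +T (b *T coeffU (g M) r)))
                     (≡.sym (updateAt-updates i {combineU} g)) (coeffU-linCombU a (g i) b (g M) r)

    g′-unchanged : ∀ {j} → j ≢ i → g′ j ≡ g j
    g′-unchanged {j} j≢i = updateAt-minimal j i {combineU} g j≢i

    g′≋𝒯′h : ∀ j r → sumT (λ k → 𝒯′ j k *T coeffU (h k) r) ≋ coeffU (g′ j) r
    g′≋𝒯′h j r with j Fin.≟ i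
    ... | no j≢i rewrite updateAt-minimal j i {combineRow} 𝒯 j≢i | g′-unchanged j≢i = g≋𝒯h j r
    ... | yes ≡.refl rewrite updateAt-updates i {combineRow} 𝒯 =
      ≋-trans (sumT-*-+-* a b (𝒯 i) (𝒯 M) (λ k → coeffU (h k) r))
              (≋-trans (+T-cong (*T-congʳ a (g≋𝒯h i r)) (*T-congʳ b (g≋𝒯h M r))) (≋-sym (g′-updated r)))

    γ′-updated : γ′ i ≡ y
    γ′-updated = updateAt-updates i _

    γ′-pivot : γ′ M ≡ γ M +ᴸ y *ᴸ (-T b)
    γ′-pivot = ≡.trans (updateAt-minimal M i _ (i≢M ∘ ≡.sym)) (updateAt-updates M γ)

    γ′-unchanged : ∀ {j} → j ≢ i → j ≢ M → γ′ j ≡ γ j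
    γ′-unchanged {j} j≢i j≢M = ≡.trans (updateAt-minimal j i _ j≢i) (updateAt-minimal j M γ j≢M)

    γ′g′-pair : ∀ r n → let Gᵢ = coeffU (g i) r; G_M = coeffU (g M) r in
      mulLT (coeffL (γ i)) Gᵢ n + mulLT (coeffL (γ M)) G_M n ≈
      mulLT (coeffL y) (coeffU (g′ i) r) n + mulLT (coeffL (γ M +ᴸ y *ᴸ (-T b))) G_M n
    γ′g′-pair r n = sym (begin
      mulLT yᶜ (coeffU (g′ i) r) n + mulLT (λ m → γ_M m + mulLT yᶜ (-T b) m) G_M n
        ≈⟨ +-cong (mulLT-congʳ yᶜ n (g′-updated r)) (mulLT-+ˡ γ_M (mulLT yᶜ (-T b)) G_M n) ⟩
      mulLT yᶜ ((a *T Gᵢ) +T (b *T G_M)) n + (Y + mulLT (mulLT yᶜ (-T b)) G_M n)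
        ≈⟨ +-cong (mulLT-+T yᶜ (a *T Gᵢ) (b *T G_M) n) (+-congˡ (sym (mulLT-*T yᶜ (-T b) G_M n))) ⟩
      (mulLT yᶜ (a *T Gᵢ) n + W) + (Y + W′)
        ≈⟨ +-congʳ (+-congʳ (trans (mulLT-*T yᶜ a Gᵢ n) (mulLT-congˡ y*a≈γᵢ Gᵢ n))) ⟩
      (X + W) + (Y + W′)  ≈⟨ +-interchange X W Y W′ ⟩
      (X + Y) + (W + W′)  ≈⟨ +-congˡ W+W′≈0 ⟩
      (X + Y) + 0#        ≈⟨ +-identityʳ _ ⟩
      X + Y               ∎)
      where
      open import Relation.Binary.Reasoning.Setoid setoid
      yᶜ = coeffL y
      γ_M = coeffL (γ M)
      Gᵢ = coeffU (g i) r
      G_M = coeffU (g M) r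
      X = mulLT (coeffL (γ i)) Gᵢ n
      Y = mulLT γ_M G_M n
      W = mulLT yᶜ (b *T G_M) n
      W′ = mulLT yᶜ ((-T b) *T G_M) n
      W+W′≈0 : W + W′ ≈ 0#
      W+W′≈0 = trans (sym (mulLT-+T yᶜ (b *T G_M) ((-T b) *T G_M) n))
                     (mulLT-≋[] yᶜ n (≋-trans (≋-sym (*T-distribʳ G_M b (-T b))) (*T-congˡ G_M (T.-‿inverseʳ b))))

    βh≈γ′g′ : ∀ r n → linCombCoeff β h r n ≈ linCombCoeff γ′ g′ r n
    βh≈γ′g′ r n = trans (βh≈γg r n) (sumA-cong-except₂ i M i≢M unchanged pair)
      where
      unchanged : ∀ j → j ≢ i → j ≢ M → mulLT (coeffL (γ j)) (coeffU (g j) r) n ≈ mulLT (coeffL (γ′ j)) (coeffU (g′ j) r) n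
      unchanged j j≢i j≢M = reflexive (≡.sym (≡.cong₂ (λ Γ G → mulLT (coeffL Γ) (coeffU G r) n)
                                                      (γ′-unchanged j≢i j≢M) (g′-unchanged j≢i)))
      pair : mulLT (coeffL (γ i)) (coeffU (g i) r) n + mulLT (coeffL (γ M)) (coeffU (g M) r) n
             ≈ mulLT (coeffL (γ′ i)) (coeffU (g′ i) r) n + mulLT (coeffL (γ′ M)) (coeffU (g′ M) r) n
      pair rewrite γ′-updated | γ′-pivot | g′-unchanged (i≢M ∘ ≡.sym) = γ′g′-pair r n

    -- Σⱼ (pullback c)ⱼ gⱼ = Σⱼ cⱼ g′ⱼ, so a relation among the g′ⱼ pulls back to one among the gⱼ.
    pullback : (Fin L → PolyT) → Fin L → PolyT
    pullback c = updateAt (updateAt c M (λ c_M → c_M +T (c i *T b))) i (_*T a)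

    pullback-updated : ∀ c → pullback c i ≡ c i *T a
    pullback-updated c = ≡.trans (updateAt-updates i _) (≡.cong (_*T a) (updateAt-minimal i M c i≢M))

    pullback-pivot : ∀ c → pullback c M ≡ c M +T (c i *T b)
    pullback-pivot c = ≡.trans (updateAt-minimal M i _ (i≢M ∘ ≡.sym)) (updateAt-updates M c)

    pullback-unchanged : ∀ c {j} → j ≢ i → j ≢ M → pullback c j ≡ c j
    pullback-unchanged c {j} j≢i j≢M = ≡.trans (updateAt-minimal j i _ j≢i) (updateAt-minimal j M c j≢M)

    pullback-combination : ∀ c r → sumT (λ j → pullback c j *T coeffU (g j) r) ≋ sumT (λ j → c j *T coeffU (g′ j) r)
    pullback-combination c r = sumT-cong-except₂ i M i≢M unchanged pair
      where
      open TSolver using (solve; _:+_; _:*_; _:=_)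
      unchanged : ∀ j → j ≢ i → j ≢ M → (pullback c j *T coeffU (g j) r) ≋ (c j *T coeffU (g′ j) r)
      unchanged j j≢i j≢M = ≋-reflexive (≡.cong₂ (λ cⱼ G → cⱼ *T coeffU G r)
                                                 (pullback-unchanged c j≢i j≢M) (≡.sym (g′-unchanged j≢i)))
      pair : ((pullback c i *T coeffU (g i) r) +T (pullback c M *T coeffU (g M) r))
             ≋ ((c i *T coeffU (g′ i) r) +T (c M *T coeffU (g′ M) r))
      pair rewrite pullback-updated c | pullback-pivot c | g′-unchanged (i≢M ∘ ≡.sym) =
        ≋-trans (solve 6 (λ cᵢ a Gᵢ c_M b G_M →
                    (cᵢ :* a) :* Gᵢ :+ (c_M :+ cᵢ :* b) :* G_M := cᵢ :* (a :* Gᵢ :+ b :* G_M) :+ c_M :* G_M)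
                  ≋-refl (c i) a (coeffU (g i) r) (c M) b (coeffU (g M) r))
                (+T-cong (*T-congʳ (c i) (≋-sym (g′-updated r))) ≋-refl)

    pullback-injectiveᵢ : ∀ c → pullback c i ≋ [] → c i ≋ []
    pullback-injectiveᵢ c c′ᵢ≋0 with *T-zero-divisor (isField⇒noZeroDivisors _≟_ isField) (c i) a
                                        (≡.subst (_≋ []) (pullback-updated c) c′ᵢ≋0)
    ... | inj₁ cᵢ≋0 = cᵢ≋0
    ... | inj₂ a≋0  = contradiction a≋0 a≉0

    pullback-injective : ∀ c → (∀ j → pullback c j ≋ []) → ∀ j → c j ≋ []
    pullback-injective c c′≋0 j with j Fin.≟ i | j Fin.≟ M
    ... | yes ≡.refl | _          = pullback-injectiveᵢ c (c′≋0 i)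
    ... | no  _      | yes ≡.refl = begin
      c M                 ≈⟨ +T-identityʳ (c M) ⟨
      c M +T []           ≈⟨ +T-cong ≋-refl (*T-zeroˡ-≋ b (pullback-injectiveᵢ c (c′≋0 i))) ⟨
      c M +T (c i *T b)   ≡⟨ pullback-pivot c ⟨
      pullback c M        ≈⟨ c′≋0 M ⟩
      []                  ∎
      where open import Relation.Binary.Reasoning.Setoid ≋-setoid
    ... | no  j≢i    | no  j≢M    = ≡.subst (_≋ []) (pullback-unchanged c j≢i j≢M) (c′≋0 j)

    independent′ : Independent g′
    independent′ c c·g′≋0 =
      pullback-injective c (independent (pullback c) λ r r* → ≋-trans (pullback-combination c r) (c·g′≋0 r r*))

    reduction : Reduction
    reduction = record
      { 𝒯 = 𝒯′ ; g = g′ ; γ = γ′ ; g≋𝒯h = g′≋𝒯′h ; βh≈γg = βh≈γ′g′ ; independent = independent′ }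

    column-cleared : ∀ {l s} → M ≢ l → (∀ j → j ≢ l → coeffU (g j) s ≋ []) → ∀ j → j ≢ l → coeffU (g′ j) s ≋ []
    column-cleared {l} {s} M≢l g≋0 j j≢l with j Fin.≟ i
    ... | yes ≡.refl = ≋-trans (g′-updated s) (+T-cong (≋-trans (*T-congʳ a (g≋0 j j≢l)) (*T-zeroʳ a))
                                                      (≋-trans (*T-congʳ b (g≋0 M M≢l)) (*T-zeroʳ b)))
    ... | no  j≢i    = ≡.subst (λ G → coeffU G s ≋ []) (≡.sym (g′-unchanged j≢i)) (g≋0 j j≢l)

  module Eliminate (𝓡 : Reduction) {i M : Fin L} (i≢M : i ≢ M) {r : ℕ}
                   (pivot≉0 : ¬ coeffU (Reduction.g 𝓡 M) r ≋ []) where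

    open Reduction 𝓡
    open RowOperation 𝓡 i≢M (coeffU (g M) r) (-T coeffU (g i) r) pivot≉0 public

    eliminated : coeffU (g′ i) r ≋ []
    eliminated = ≋-trans (g′-updated r)
      (≋-trans (+T-cong ≋-refl (≋-trans (≋-sym (-T‿distribˡ-*T Gᵢ G_M)) (-T-cong (*T-comm Gᵢ G_M))))
               (T.-‿inverseʳ (G_M *T Gᵢ)))
      where Gᵢ = coeffU (g i) r
            G_M = coeffU (g M) r

  initial : Independent h → Reduction
  initial h-independent = record
    { 𝒯 = unit ; g = h ; γ = β
    ; g≋𝒯h = λ j r → sum-unit j (λ k → coeffU (h k) r)
    ; βh≈γg = λ _ _ → refl
    ; independent = h-independent }

  pivot-exists : (𝓡 : Reduction) (M : Fin L) → Σ ℕ λ r → KStar p K r × ¬ coeffU (Reduction.g 𝓡 M) r ≋ []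
  pivot-exists 𝓡 M with any? (λ r → KStar? 1<p K r ×-dec ¬? (≋[]? _≟_ (coeffU (g M) r))) K
    where open Reduction 𝓡
  ... | yes pivot = let r , _ , r* , g≉0 = find pivot in r , r* , g≉0
  ... | no  none  = contradiction (coeff-≈ unit≋0 0) (proj₁ isField)
    where
    open Reduction 𝓡
    row-vanishes : ∀ r → KStar p K r → sumT (λ j → unit M j *T coeffU (g j) r) ≋ []
    row-vanishes r r* = ≋-trans (sum-unit M (λ j → coeffU (g j) r))
                                (decidable-stable (≋[]? _≟_ (coeffU (g M) r)) λ g≉0 → none (lose (proj₁ r*) (r* , g≉0)))
    unit≋0 : oneT ≋ []
    unit≋0 = ≡.subst (_≋ []) (updateAt-updates M (λ _ → [])) (independent (unit M) row-vanishes M)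

  Cleared : Reduction → (Fin L → ℕ) → List (Fin L) → Set
  Cleared 𝓡 pivot rows = ∀ {l} → l ∈ rows → ∀ j → j ≢ l → coeffU (Reduction.g 𝓡 j) (pivot l) ≋ []

  record Pivoted (rows : List (Fin L)) : Set where
    field
      reduction : Reduction
      pivot : Fin L → ℕ
      pivot-K* : ∀ {l} → l ∈ rows → KStar p K (pivot l)
      cleared : Cleared reduction pivot rows

  module _ {done : List (Fin L)} (pivot : Fin L → ℕ) {M : Fin L} (M∉done : All (M ≢_) done) (r : ℕ) where

    record Clearing (rows : List (Fin L)) : Set where
      field
        reduction : Reduction
        pivot≉0 : ¬ coeffU (Reduction.g reduction M) r ≋ []
        old-cleared : Cleared reduction pivot done
        new-cleared : ∀ {j} → j ∈ rows → j ≢ M → coeffU (Reduction.g reduction j) r ≋ []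

    clear : ∀ {rows} i → Clearing rows → Clearing (i ∷ rows)
    clear i C with i Fin.≟ M
    ... | yes ≡.refl = record
      { reduction = Clearing.reduction C
      ; pivot≉0 = Clearing.pivot≉0 C
      ; old-cleared = Clearing.old-cleared C
      ; new-cleared = λ { (here ≡.refl) M≢M → contradiction ≡.refl M≢M
                        ; (there j∈rows) → Clearing.new-cleared C j∈rows } }
    ... | no  i≢M    = record
      { reduction = E.reduction
      ; pivot≉0 = ≡.subst (λ G → ¬ coeffU G r ≋ []) (≡.sym (E.g′-unchanged (i≢M ∘ ≡.sym))) (Clearing.pivot≉0 C)
      ; old-cleared = λ l∈done → E.column-cleared (All.lookup M∉done l∈done) (Clearing.old-cleared C l∈done)
      ; new-cleared = new-cleared }
      where
      module E = Eliminate (Clearing.reduction C) i≢M (Clearing.pivot≉0 C)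
      new-cleared : ∀ {j} → j ∈ i ∷ _ → j ≢ M → coeffU (E.g′ j) r ≋ []
      new-cleared {j} j∈ j≢M with j Fin.≟ i | j∈
      ... | yes ≡.refl | _               = E.eliminated
      ... | no  j≢i    | here j≡i        = contradiction j≡i j≢i
      ... | no  j≢i    | there j∈rows    = ≡.subst (λ G → coeffU G r ≋ []) (≡.sym (E.g′-unchanged j≢i))
                                                   (Clearing.new-cleared C j∈rows j≢M)

    clear-all : ∀ rows → Clearing [] → Clearing rows
    clear-all []         C = C
    clear-all (i ∷ rows) C = clear i (clear-all rows C)

  pivot-row : ∀ {done} (M : Fin L) → All (M ≢_) done → Pivoted done → Pivoted (M ∷ done)
  pivot-row {done} M M∉done P = record
    { reduction = Clearing.reduction C
    ; pivot = pivot′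
    ; pivot-K* = λ { (here ≡.refl) → ≡.subst (KStar p K) (≡.sym pivot′-M) r*
                   ; (there l∈done) → ≡.subst (KStar p K) (≡.sym (pivot′-old l∈done)) (pivot-K* l∈done) }
    ; cleared = λ { (here ≡.refl) j j≢M → ≡.subst (λ s → g′ j s ≋ []) (≡.sym pivot′-M)
                                                   (Clearing.new-cleared C (∈-allFin j) j≢M)
                  ; (there l∈done) j j≢l → ≡.subst (λ s → g′ j s ≋ []) (≡.sym (pivot′-old l∈done))
                                                    (Clearing.old-cleared C l∈done j j≢l) } }
    where
    open Pivoted P
    r = proj₁ (pivot-exists reduction M)
    r* = proj₁ (proj₂ (pivot-exists reduction M))
    pivot′ : Fin L → ℕ
    pivot′ = updateAt pivot M (λ _ → r)
    pivot′-M : pivot′ M ≡ r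
    pivot′-M = updateAt-updates M pivot
    pivot′-old : ∀ {l} → l ∈ done → pivot′ l ≡ pivot l
    pivot′-old l∈done = updateAt-minimal _ M pivot (All.lookup M∉done l∈done ∘ ≡.sym)
    C : Clearing pivot M∉done r (allFin L)
    C = clear-all pivot M∉done r (allFin L) record
      { reduction = reduction
      ; pivot≉0 = proj₂ (proj₂ (pivot-exists reduction M))
      ; old-cleared = cleared
      ; new-cleared = λ () }
    g′ : Fin L → ℕ → PolyT
    g′ j = coeffU (Reduction.g (Clearing.reduction C) j)

  pivot-all : Reduction → ∀ rows → Unique rows → Pivoted rows
  pivot-all 𝓡 []         []                = record { reduction = 𝓡 ; pivot = λ _ → 0 ; pivot-K* = λ () ; cleared = λ () }
  pivot-all 𝓡 (M ∷ rows) (M∉rows ∷ unique) = pivot-row M M∉rows (pivot-all 𝓡 rows unique)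

∈-KUnion : ∀ {L} (Ks : Fin L → List ℕ) k {r} → r ∈ Ks k → r ∈ KUnion Ks
∈-KUnion Ks k r∈Kₖ = ∈-concat⁺ (tabulate⁺ k r∈Kₖ)

module Support (F : CommutativeRing 0ℓ 0ℓ) where

  open import Data.Nat using (_≤_)
  open import Data.List using ([])
  open import Data.List.Membership.Propositional using (_∈_; _∉_)
  open import Data.List.Membership.DecPropositional Data.Nat._≟_ using (_∈?_)
  open import Data.Product using (_,_; proj₂)
  open import Function using (_∘_)
  open import Relation.Nullary using (yes; no; contradiction)

  open Over F
  open Polynomials F
  open PolynomialSums F
  open StarIndices using (KStar⇒positive)

  VanishesOutside : List ℕ → PolyTU → Set
  VanishesOutside K f = ∀ r → 1 ≤ r → r ∉ K → coeffU f r ≋ []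

  supported⇒vanishesOutside : ∀ {K f} → SupportedOn K f → VanishesOutside K f
  supported⇒vanishesOutside f-supported r 1≤r r∉K = coeffwise (proj₂ (f-supported r 1≤r) r∉K)

  vanishesOutside⇒supportedInSubset : ∀ {K f} → VanishesOutside K f → SupportedInSubsetOf K f
  vanishesOutside⇒supportedInSubset {K} f≋0 r 1≤r f≉0 with r ∈? K
  ... | yes r∈K = r∈K
  ... | no  r∉K = contradiction (coeff-≈ (f≋0 r 1≤r r∉K)) f≉0

  vanishesOutside-∑ : ∀ {L K} (h : Fin L → PolyTU) (𝒯 : Fin L → PolyT) g → (∀ k → VanishesOutside K (h k)) →
                      (∀ r → sumT (λ k → 𝒯 k *T coeffU (h k) r) ≋ coeffU g r) → VanishesOutside K g
  vanishesOutside-∑ h 𝒯 g h≋0 g≋𝒯h r 1≤r r∉K = ≋-trans (≋-sym (g≋𝒯h r))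
    (sumT-≋[] λ k → ≋-trans (*T-congʳ (𝒯 k) (h≋0 k r 1≤r r∉K)) (*T-zeroʳ (𝒯 k)))

  vanishesOutside-⊆ : ∀ {K K′ f} → (∀ {r} → r ∈ K → r ∈ K′) → VanishesOutside K f → VanishesOutside K′ f
  vanishesOutside-⊆ K⊆K′ f≋0 r 1≤r r∉K′ = f≋0 r 1≤r (r∉K′ ∘ K⊆K′)

  starCoeff-K* : ∀ {p K Kⱼ f r} → SupportedOn Kⱼ f → KStar p K r → starCoeffOnKj Kⱼ f r ≋ coeffU f r
  starCoeff-K* {Kⱼ = Kⱼ} {r = r} f-supported r* with r ∈? Kⱼ
  ... | yes _    = ≋-refl
  ... | no r∉Kⱼ = ≋-sym (coeffwise (proj₂ (f-supported r (KStar⇒positive r*)) r∉Kⱼ))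

lemma3p2 : (F : CommutativeRing 0ℓ 0ℓ) →
  let open CommutativeRing F using (_≈_) in
  let open Over F in
  (q p : ℕ) → IsField → HasCard q → HasChar p →
  (L : ℕ) (Ks : Fin L → List ℕ) → ((j : Fin L) → PosSet (Ks j)) →
  (h : Fin L → PolyTU) → ((j : Fin L) → SupportedOn (Ks j) (h j)) →
  KStarPortionLinIndep p Ks h →
  (β : Fin L → Laurent) →
  Σ (Fin L → Fin L → PolyT) (λ 𝒯 → Σ (Fin L → PolyTU) (λ g →
    ((j : Fin L) → SupportedInSubsetOf (KUnion Ks) (g j)) ×
    ((j : Fin L) (r : ℕ) → sumT (λ k → 𝒯 j k *T coeffU (h k) r) ≈T coeffU (g j) r) ×
    Σ (Fin L → ℕ) (λ T → ((j : Fin L) → KStar p (KUnion Ks) (T j)) ×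
      ((i j : Fin L) → ¬ (i ≡ j) → IsZeroT (coeffU (g i) (T j)))) ×
    Σ (Fin L → Laurent) (λ γ →
      (r : ℕ) (n : ℤ) → linCombCoeff β h r n ≈ linCombCoeff γ g r n)))
lemma3p2 F q p isField card (p-prime , _) L Ks _ h h-supported h*-independent β =
  𝒯 , g , g-supported , (λ j r → coeff-≈ (g≋𝒯h j r)) ,
  (pivot , (λ j → pivot-K* (∈-allFin j)) , λ i j i≢j → coeff-≈ (cleared (∈-allFin j) i i≢j)) ,
  γ , βh≈γg
  where
  open Over F
  open Polynomials F
  open PolynomialSums F
  open Support F
  _≟_ = FiniteFields.HasCard⇒Decidable F card
  open Elimination F _≟_ isField p (nonTrivial⇒n>1 p {{prime⇒nonTrivial p-prime}}) (KUnion Ks) h β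
  h-independent : Independent h
  h-independent c c·h≋0 j = coeffwise (h*-independent c (λ r r* → coeff-≈ (≋-trans
    (sumT-cong λ k → *T-congʳ (c k) (starCoeff-K* {f = h k} (h-supported k) r*)) (c·h≋0 r r*))) j)
  open Pivoted (pivot-all (initial h-independent) (allFin L) (allFin⁺ L))
  open Reduction reduction
  h-vanishes : ∀ k → VanishesOutside (KUnion Ks) (h k)
  h-vanishes k = vanishesOutside-⊆ {f = h k} (∈-KUnion Ks k) (supported⇒vanishesOutside {f = h k} (h-supported k))
  g-supported : ∀ j → SupportedInSubsetOf (KUnion Ks) (g j)
  g-supported j = vanishesOutside⇒supportedInSubset {f = g j} (vanishesOutside-∑ h (𝒯 j) (g j) h-vanishes (g≋𝒯h j))
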